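{- Let $G$ be a graph. The following are equivalent: (a) $G$ is an Eulerian graph; (b) every vertex of $G$ has even degree; (c) $\mathbb 1\in H_1(G,\mathbb Z/2\mathbb Z)$; (d) $\rho_T^{ -1}(\mathbb 1_T)=\mathbb 1$ for all spanning trees $T$ of $G$; (e) $G$ is bridgeless (i.e. $G\setminus e$ is connected for every edge $e$) and $\rho_T^{ -1}(\mathbb 1_T)$ is the same element for all spanning trees $T$ of $G$.
   Context: A graph is connected and finite, loops and multiple edges allowed, with edges $e_1,\dots,e_m$. $G$ is Eulerian if it has a closed walk traversing every edge exactly once. $C_1(G,\mathbb Z/2\mathbb Z)$ is the $\mathbb Z/2\mathbb Z$-vector space with basis the edges; $H_1(G,\mathbb Z/2\mathbb Z)$ is the subspace of $\sum a_ke_k$ such that for each vertex $v$, the sum of the $a_k$ over edge-ends at $v$ (a loop at $v$ counted twice) is $0$ mod 2 (equivalently, the balancing condition for any orientation). $\mathbb 1=e_1+\dots+e_m$. For a spanning tree $T$, $E^c(T)$ is the set of edges not in $T$, $M_2(E^c(T))$ the subspace spanned by them, $\mathbb 1_T=\sum_{e\in E^c(T)}e$, and $\rho_T:H_1(G,\mathbb Z/2\mathbb Z)\to M_2(E^c(T))$ is the restriction map (setting coefficients of edges of $T$ to $0$), which is an isomorphism. -}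

module Defs where

open import Data.Nat using (ℕ; zero; suc; _+_)
open import Data.Nat.Divisibility using (_∣_)
open import Data.Fin using (Fin; _≟_)
open import Data.Bool using (Bool; true; false; if_then_else_; not)
open import Data.Product using (Σ; ∃; ∃-syntax; _×_; _,_; proj₁; proj₂)
open import Data.Sum using (_⊎_)
open import Data.List using (List; []; _∷_; map)
open import Data.Nat.ListAction using (sum)
open import Data.List.Relation.Unary.Unique.Propositional using (Unique)
open import Relation.Nullary using (¬_; does)
open import Relation.Binary.PropositionalEquality using (_≡_; _≢_)

-- A finite graph with loops and multiple edges: vertices Fin nV, edges Fin nE,
-- each edge has an (unordered) pair of end vertices, recorded as an ordered pair.
record Graph : Set where
  field
    nV    : ℕ
    nE    : ℕ
    ends  : Fin nE → Fin nV × Fin nV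

open Graph public

-- a set of edges (also: an element of C_1(G, Z/2Z), coefficients in Bool ≅ Z/2Z)
EdgeSet : Graph → Set
EdgeSet G = Fin (nE G) → Bool

C₁ : Graph → Set
C₁ = EdgeSet

allEdges : (G : Graph) → EdgeSet G
allEdges G _ = true

Joins : (G : Graph) → Fin (nE G) → Fin (nV G) → Fin (nV G) → Set
Joins G e u v = (ends G e ≡ (u , v)) ⊎ (ends G e ≡ (v , u))

data Walk (G : Graph) (S : EdgeSet G) : Fin (nV G) → Fin (nV G) → Set where
  nil  : (v : Fin (nV G)) → Walk G S v v
  cons : {u v w : Fin (nV G)} (e : Fin (nE G)) → S e ≡ true → Joins G e u v →
         Walk G S v w → Walk G S u w

walkEdges : {G : Graph} {S : EdgeSet G} {u w : Fin (nV G)} → Walk G S u w → List (Fin (nE G))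
walkEdges (nil _) = []
walkEdges (cons e _ _ p) = e ∷ walkEdges p

-- the spanning subgraph (all vertices, edges S) is connected (and nonempty)
ConnectedOn : (G : Graph) → EdgeSet G → Set
ConnectedOn G S = Fin (nV G) × ((u v : Fin (nV G)) → Walk G S u v)

Connected : Graph → Set
Connected G = ConnectedOn G (allEdges G)

without : (G : Graph) → Fin (nE G) → EdgeSet G
without G e f = not (does (f ≟ e))

Bridgeless : Graph → Set
Bridgeless G = (e : Fin (nE G)) → ConnectedOn G (without G e)

occ : {n : ℕ} → Fin n → List (Fin n) → ℕ
occ e [] = 0
occ e (f ∷ fs) = (if does (f ≟ e) then 1 else 0) + occ e fs

Eulerian : Graph → Set
Eulerian G = Σ (Fin (nV G)) λ v → Σ (Walk G (allEdges G) v v) λ w →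
  (e : Fin (nE G)) → occ e (walkEdges w) ≡ 1

ΣE : (G : Graph) → (Fin (nE G) → ℕ) → ℕ
ΣE G f = sum (map f (Data.List.Base.allFin (nE G)))
  where import Data.List.Base

-- number of edge-ends of e at v (a loop at v counts twice)
endsAt : (G : Graph) → Fin (nE G) → Fin (nV G) → ℕ
endsAt G e v = (if does (proj₁ (ends G e) ≟ v) then 1 else 0)
             + (if does (proj₂ (ends G e) ≟ v) then 1 else 0)

degree : (G : Graph) → Fin (nV G) → ℕ
degree G v = ΣE G λ e → endsAt G e v

-- x ∈ H_1(G, Z/2Z): at each vertex the sum of coefficients over edge-ends is even
InH₁ : (G : Graph) → C₁ G → Set
InH₁ G x = (v : Fin (nV G)) → 2 ∣ ΣE G (λ e → if x e then endsAt G e v else 0)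

𝟙 : (G : Graph) → C₁ G
𝟙 G _ = true

_≈C_ : {G : Graph} → C₁ G → C₁ G → Set
_≈C_ {G} x y = (e : Fin (nE G)) → x e ≡ y e

Acyclic : (G : Graph) → EdgeSet G → Set
Acyclic G T = (v : Fin (nV G)) (w : Walk G T v v) →
  Unique (walkEdges w) → walkEdges w ≡ []

SpanningTree : (G : Graph) → EdgeSet G → Set
SpanningTree G T = ConnectedOn G T × Acyclic G T

𝟙ᵀ : {G : Graph} → EdgeSet G → C₁ G
𝟙ᵀ T e = not (T e)

-- ρ_T : restriction to M₂(E^c(T)) (set coefficients of edges of T to 0)
ρ : {G : Graph} → EdgeSet G → C₁ G → C₁ G
ρ T x e = if T e then false else x e

-- "ρ_T⁻¹(𝟙_T) = y": y is the (unique, as ρ_T is an isomorphism) element of H₁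
-- with ρ_T y = 𝟙_T
IsRhoInvOneT : (G : Graph) → EdgeSet G → C₁ G → Set
IsRhoInvOneT G T y = InH₁ G y × _≈C_ {G} (ρ {G} T y) (𝟙ᵀ {G} T)

{-# OPTIONS --safe #-}
-- Chains are Bool-valued (Bool with xor is Z/2Z) and the boundary ∂ z x is the parity of the
-- number of ends of z-edges at x, so H₁ is the kernel of ∂ and (b) ⇔ (c) holds by definition.
-- The chain of a walk from u to v has boundary u + v; this gives (a) ⇒ (b).
-- Everything else rests on Hierholzer's construction: if ∂ S = u + v, there is a trail from
-- u to v inside S that uses every S-edge at each of its vertices. For S = 𝟙 in a connected
-- graph this trail is an Euler circuit, which gives (c) ⇒ (a). For a cycle S supported in an
-- acyclic T it would be a closed trail in T, so a tree carries no nonzero cycle. Now if 𝟙 and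
-- y = ρ_T⁻¹(𝟙_T) are both cycles, then 𝟙 + y is a cycle supported in T, hence y = 𝟙: this is
-- (c) ⇒ (d). Conversely, a spanning tree grown by Prim's algorithm, together with
-- y = 𝟙_T + Σ_{e ∉ T} (a T-path joining the ends of e), gives an element with ρ_T y = 𝟙_T, so
-- (d) forces 𝟙 ∈ H₁. For (d) ⇒ (e), the chain 𝟙 + e has boundary equal to the two ends of e,
-- so a trail joins them in G ∖ e. For (e) ⇒ (d), at an edge f compare with a spanning tree of
-- G ∖ f: its ρ⁻¹(𝟙) has coefficient 1 at f.
module Submission where

open import Algebra.Bundles using (CommutativeRing)
open import Data.Bool using (Bool; true; false; not; _∧_; _∨_; _xor_; if_then_else_)
  renaming (_≟_ to _≟ᵇ_)
open import Data.Bool.Properties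
  using ( xor-∧-commutativeRing; ¬-not; not-involutive; not-distribˡ-xor
        ; xor-identityʳ; xor-comm; xor-assoc; xor-same
        ; ∧-distribʳ-xor; ∧-assoc; ∧-zeroʳ; ∧-identityʳ; ∨-zeroʳ )
open import Data.Empty using (⊥-elim)
open import Data.Fin using (Fin; zero; suc; _≟_; punchIn)
open import Data.Fin.Properties using (punchInᵢ≢i; any?)
import Data.Fin.Subset as Subset
open import Data.Fin.Subset.Properties using (p⊆q⇒∣p∣≤∣q∣; p⊂q⇒∣p∣<∣q∣)
open import Data.List using ([]; _∷_; _++_; tabulate; map; allFin)
open import Data.List.Membership.Propositional using (_∈_; _∉_)
open import Data.List.Membership.Propositional.Properties using (∈-++⁺ˡ; ∈-++⁺ʳ)
open import Data.List.Properties using (map-tabulate)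
open import Data.List.Relation.Binary.Disjoint.Propositional using (Disjoint)
open import Data.List.Relation.Unary.All using (All; []; _∷_)
import Data.List.Relation.Unary.All as All
open import Data.List.Relation.Unary.AllPairs using ([]; _∷_)
open import Data.List.Relation.Unary.Any using (Any; here; there)
import Data.List.Relation.Unary.Any as Any
open import Data.List.Relation.Unary.Any.Properties using () renaming (++⁻ to Any-++⁻)
open import Data.List.Relation.Unary.Unique.Propositional using (Unique)
open import Data.List.Relation.Unary.Unique.Propositional.Properties using (Unique[x∷xs]⇒x∉xs; ++⁺)
open import Data.Nat using (ℕ; zero; suc; _+_; _*_; _<_; _≤_)
open import Data.Nat.Divisibility using (_∣_; divides; ∣-refl; ∣m∣n⇒∣m+n)
open import Data.Nat.Induction using (<-wellFounded)
open import Data.Nat.ListAction using (sum)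
open import Data.Nat.Properties using (≤-<-trans)
open import Data.Product using (Σ; ∃; _×_; _,_; proj₁; proj₂)
import Data.Product as Product
open import Data.Sum using (_⊎_; inj₁; inj₂)
import Data.Sum as Sum
import Data.Vec as Vec
open import Data.Vec.Properties using (lookup∘tabulate; []=⇒lookup; lookup⇒[]=)
open import Function using (_∘_; id; case_of_)
open import Function.Bundles using (_⇔_; mk⇔; Equivalence)
open import Induction.WellFounded using (Acc; acc)
open import Relation.Binary.PropositionalEquality
open import Relation.Nullary using (Dec; does; yes; no; ¬_)
open import Relation.Nullary.Decidable using (dec-true; dec-false; _⊎-dec_; _×-dec_; ¬?; decidable-stable)

open import Algebra.Properties.Semiring.Sum (CommutativeRing.semiring xor-∧-commutativeRing)
  using (sum-syntax; sum-cong-≗; sum-replicate-zero; sum-remove; ∑-distrib-+; ∑-comm; *-distribˡ-sum; *-distribʳ-sum)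

open import Defs

odd : ℕ → Bool
odd zero    = false
odd (suc n) = not (odd n)

odd-+ : ∀ m n → odd (m + n) ≡ odd m xor odd n
odd-+ zero    n = refl
odd-+ (suc m) n = trans (cong not (odd-+ m n)) (not-distribˡ-xor (odd m) (odd n))

odd-indicator : ∀ b → odd (if b then 1 else 0) ≡ b
odd-indicator true  = refl
odd-indicator false = refl

odd-if : ∀ b n → odd (if b then n else 0) ≡ b ∧ odd n
odd-if true  n = refl
odd-if false n = refl

2∣⇒even : ∀ {n} → 2 ∣ n → odd n ≡ false
2∣⇒even (divides q refl) = odd-double q
  where
  odd-double : ∀ q → odd (q * 2) ≡ false
  odd-double zero    = refl
  odd-double (suc q) = trans (not-involutive (odd (q * 2))) (odd-double q)

even⇒2∣ : ∀ n → odd n ≡ false → 2 ∣ n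
even⇒2∣ zero          _    = divides 0 refl
even⇒2∣ (suc zero)    ()
even⇒2∣ (suc (suc n)) even = ∣m∣n⇒∣m+n ∣-refl (even⇒2∣ n (trans (sym (not-involutive (odd n))) even))

xor-cancel-middle : ∀ a b c → (a xor b) xor (b xor c) ≡ a xor c
xor-cancel-middle a b c = trans (xor-assoc a b (b xor c)) (cong (a xor_) (xor-cancelˡ b c))
  where
  xor-cancelˡ : ∀ b c → b xor (b xor c) ≡ c
  xor-cancelˡ false c = refl
  xor-cancelˡ true  c = not-involutive c

odd-sum : ∀ {n} (f : Fin n → ℕ) → odd (sum (tabulate f)) ≡ ∑[ i < n ] odd (f i)
odd-sum {zero}  f = refl
odd-sum {suc n} f = trans (odd-+ (f zero) _) (cong (odd (f zero) xor_) (odd-sum (f ∘ suc)))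

∑-false : ∀ {n} {f : Fin n → Bool} → (∀ i → f i ≡ false) → ∑[ i < n ] f i ≡ false
∑-false {n} f≡false = trans (sum-cong-≗ f≡false) (sum-replicate-zero n)

∑-supported : ∀ {n} {f : Fin n → Bool} i → (∀ j → j ≢ i → f j ≡ false) → ∑[ j < n ] f j ≡ f i
∑-supported {suc _} {f} i off = begin
  ∑[ j < _ ] f j                      ≡⟨ sum-remove f ⟩
  f i xor ∑[ j < _ ] f (punchIn i j)  ≡⟨ cong (f i xor_) (∑-false (λ j → off _ (punchInᵢ≢i i j))) ⟩
  f i xor false                       ≡⟨ xor-identityʳ (f i) ⟩
  f i                                 ∎
  where open ≡-Reasoning

δ : ∀ {n} → Fin n → Fin n → Bool
δ i j = does (i ≟ j)

δ-refl : ∀ {n} (i : Fin n) → δ i i ≡ true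
δ-refl i = dec-true (i ≟ i) refl

δ⇒≡ : ∀ {n} {i j : Fin n} → δ i j ≡ true → i ≡ j
δ⇒≡ {i = i} {j} h with i ≟ j
... | yes i≡j = i≡j
δ⇒≡ () | no _

δ-sym : ∀ {n} (i j : Fin n) → δ i j ≡ δ j i
δ-sym i j with i ≟ j | j ≟ i
... | yes _   | yes _   = refl
... | no _    | no _    = refl
... | yes i≡j | no j≢i = ⊥-elim (j≢i (sym i≡j))
... | no i≢j  | yes j≡i = ⊥-elim (i≢j (sym j≡i))

_⊕_ : ∀ {n} → (Fin n → Bool) → (Fin n → Bool) → Fin n → Bool
(p ⊕ q) i = p i xor q i

_∪_ : ∀ {n} → (Fin n → Bool) → (Fin n → Bool) → Fin n → Bool
(p ∪ q) i = p i ∨ q i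

_⊆_ : ∀ {n} → (Fin n → Bool) → (Fin n → Bool) → Set
p ⊆ q = ∀ {i} → p i ≡ true → q i ≡ true

∪-elim : ∀ {n} {p q : Fin n → Bool} {i} → (p ∪ q) i ≡ true → p i ≡ true ⊎ q i ≡ true
∪-elim {p = p} {i = i} h with p i
... | true  = inj₁ refl
... | false = inj₂ h

∪-introˡ : ∀ {n} {p q : Fin n → Bool} → p ⊆ (p ∪ q)
∪-introˡ h rewrite h = refl

∪-introʳ : ∀ {n} {p q : Fin n → Bool} → q ⊆ (p ∪ q)
∪-introʳ {p = p} {i = i} h rewrite h = ∨-zeroʳ (p i)

size : ∀ {n} → (Fin n → Bool) → ℕ
size p = Subset.∣ Vec.tabulate p ∣

private
  ∈-tabulate⁺ : ∀ {n} {p : Fin n → Bool} {i} → p i ≡ true → i Subset.∈ Vec.tabulate p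
  ∈-tabulate⁺ {p = p} {i} pi = lookup⇒[]= i (Vec.tabulate p) (trans (lookup∘tabulate p i) pi)

  ∈-tabulate⁻ : ∀ {n} {p : Fin n → Bool} {i} → i Subset.∈ Vec.tabulate p → p i ≡ true
  ∈-tabulate⁻ {p = p} {i} i∈p = trans (sym (lookup∘tabulate p i)) ([]=⇒lookup i∈p)

  tabulate-⊆ : ∀ {n} {p q : Fin n → Bool} → p ⊆ q → Vec.tabulate p Subset.⊆ Vec.tabulate q
  tabulate-⊆ p⊆q = ∈-tabulate⁺ ∘ p⊆q ∘ ∈-tabulate⁻

size-mono : ∀ {n} {p q : Fin n → Bool} → p ⊆ q → size p ≤ size q
size-mono {p = p} {q} p⊆q = p⊆q⇒∣p∣≤∣q∣ (tabulate-⊆ {p = p} {q} p⊆q)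

size-strict : ∀ {n} {p q : Fin n → Bool} {i} → p ⊆ q → q i ≡ true → p i ≡ false → size p < size q
size-strict {p = p} {q} p⊆q qi pi =
  p⊂q⇒∣p∣<∣q∣ (tabulate-⊆ {p = p} {q} p⊆q , _ , ∈-tabulate⁺ qi ,
               λ i∈p → case trans (sym pi) (∈-tabulate⁻ {p = p} i∈p) of λ ())

occ-∉ : ∀ {n} {e : Fin n} {xs} → e ∉ xs → occ e xs ≡ 0
occ-∉ {xs = []} _ = refl
occ-∉ {e = e} {f ∷ xs} e∉ rewrite dec-false (f ≟ e) (e∉ ∘ here ∘ sym) = occ-∉ (e∉ ∘ there)

occ-unique-∈ : ∀ {n} {e : Fin n} {xs} → Unique xs → e ∈ xs → occ e xs ≡ 1
occ-unique-∈ {e = e} {e ∷ xs} u (here refl)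
  rewrite dec-true (e ≟ e) refl = cong suc (occ-∉ (Unique[x∷xs]⇒x∉xs u))
occ-unique-∈ {e = e} {f ∷ xs} (f≢ ∷ u) (there e∈)
  rewrite dec-false (f ≟ e) (All.lookup f≢ e∈) = occ-unique-∈ u e∈

-- The boundary map C₁ → C₀

module _ (G : Graph) where

  private
    V E : Set
    V = Fin (nV G)
    E = Fin (nE G)

  open import Data.List.Membership.DecPropositional (_≟_ {nE G}) using (_∈?_)

  end₁ end₂ : E → V
  end₁ e = proj₁ (ends G e)
  end₂ e = proj₂ (ends G e)

  -- A loop has incidence false at its vertex: it contributes two edge-ends there.
  incidence : E → V → Bool
  incidence e = δ (end₁ e) ⊕ δ (end₂ e)

  ∂ : C₁ G → V → Bool
  ∂ z x = ∑[ e < nE G ] (z e ∧ incidence e x)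

  IsCycle : C₁ G → Set
  IsCycle z = ∀ x → ∂ z x ≡ false

  odd-endsAt : ∀ e x → odd (endsAt G e x) ≡ incidence e x
  odd-endsAt e x = trans (odd-+ (if δ (end₁ e) x then 1 else 0) _)
                         (cong₂ _xor_ (odd-indicator (δ (end₁ e) x)) (odd-indicator (δ (end₂ e) x)))

  odd-ΣE-endsAt : ∀ z x → odd (ΣE G (λ e → if z e then endsAt G e x else 0)) ≡ ∂ z x
  odd-ΣE-endsAt z x = begin
    odd (sum (map f (allFin (nE G))))  ≡⟨ cong (odd ∘ sum) (map-tabulate id f) ⟩
    odd (sum (tabulate f))             ≡⟨ odd-sum f ⟩
    ∑[ e < nE G ] odd (f e)            ≡⟨ sum-cong-≗ (λ e → trans (odd-if (z e) _) (cong (z e ∧_) (odd-endsAt e x))) ⟩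
    ∂ z x                              ∎
    where
    open ≡-Reasoning

    f : E → ℕ
    f e = if z e then endsAt G e x else 0

  InH₁⇔IsCycle : ∀ {z} → InH₁ G z ⇔ IsCycle z
  InH₁⇔IsCycle {z} = mk⇔ (λ z∈H₁ x → trans (sym (odd-ΣE-endsAt z x)) (2∣⇒even (z∈H₁ x)))
                         (λ cycle x → even⇒2∣ _ (trans (odd-ΣE-endsAt z x) (cycle x)))

  ∂-cong : ∀ {z w} → (∀ e → z e ≡ w e) → ∀ x → ∂ z x ≡ ∂ w x
  ∂-cong z≗w x = sum-cong-≗ (λ e → cong (_∧ incidence e x) (z≗w e))

  ∂-⊕ : ∀ z w x → ∂ (z ⊕ w) x ≡ ∂ z x xor ∂ w x
  ∂-⊕ z w x = trans (sum-cong-≗ (λ e → ∧-distribʳ-xor (incidence e x) (z e) (w e)))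
                    (∑-distrib-+ (λ e → z e ∧ incidence e x) (λ e → w e ∧ incidence e x))

  ∂-δ : ∀ e x → ∂ (δ e) x ≡ incidence e x
  ∂-δ e x = trans (∑-supported e (λ f f≢e → cong (_∧ incidence f x) (dec-false (e ≟ f) (f≢e ∘ sym))))
                  (cong (_∧ incidence e x) (δ-refl e))

  ∂-∑ : ∀ {m} (c : Fin m → Bool) (z : Fin m → C₁ G) x →
        ∂ (λ f → ∑[ i < m ] (c i ∧ z i f)) x ≡ ∑[ i < m ] (c i ∧ ∂ (z i) x)
  ∂-∑ {m} c z x = begin
    ∑[ f < nE G ] ((∑[ i < m ] (c i ∧ z i f)) ∧ incidence f x)
      ≡⟨ sum-cong-≗ (λ f → *-distribʳ-sum (incidence f x) (λ i → c i ∧ z i f)) ⟩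
    ∑[ f < nE G ] ∑[ i < m ] ((c i ∧ z i f) ∧ incidence f x)
      ≡⟨ ∑-comm (λ f i → (c i ∧ z i f) ∧ incidence f x) ⟩
    ∑[ i < m ] ∑[ f < nE G ] ((c i ∧ z i f) ∧ incidence f x)
      ≡⟨ sum-cong-≗ (λ i → sum-cong-≗ (λ f → ∧-assoc (c i) (z i f) (incidence f x))) ⟩
    ∑[ i < m ] ∑[ f < nE G ] (c i ∧ (z i f ∧ incidence f x))
      ≡⟨ sum-cong-≗ (λ i → *-distribˡ-sum (c i) (λ f → z i f ∧ incidence f x)) ⟨
    ∑[ i < m ] (c i ∧ ∂ (z i) x)
      ∎
    where open ≡-Reasoning

  Touches : E → V → Set
  Touches e x = end₁ e ≡ x ⊎ end₂ e ≡ x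

  touches? : ∀ e x → Dec (Touches e x)
  touches? e x = (end₁ e ≟ x) ⊎-dec (end₂ e ≟ x)

  Joins-sym : ∀ {e u w} → Joins G e u w → Joins G e w u
  Joins-sym = Sum.swap

  Joins⇒ends : ∀ {e u w} → Joins G e u w → (end₁ e ≡ u × end₂ e ≡ w) ⊎ (end₁ e ≡ w × end₂ e ≡ u)
  Joins⇒ends = Sum.map (λ p → cong proj₁ p , cong proj₂ p) (λ p → cong proj₁ p , cong proj₂ p)

  Joins⇒Touches : ∀ {e u w} → Joins G e u w → Touches e u
  Joins⇒Touches j = Sum.map proj₁ proj₂ (Joins⇒ends j)

  Touches⇒Joins : ∀ {e x} → Touches e x → ∃ (Joins G e x)
  Touches⇒Joins {e} (inj₁ refl) = end₂ e , inj₁ refl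
  Touches⇒Joins {e} (inj₂ refl) = end₁ e , inj₂ refl

  Touches-Joins : ∀ {e u w x} → Joins G e u w → Touches e x → x ≡ u ⊎ x ≡ w
  Touches-Joins j t with Joins⇒ends j | t
  ... | inj₁ (refl , _) | inj₁ refl = inj₁ refl
  ... | inj₁ (_ , refl) | inj₂ refl = inj₂ refl
  ... | inj₂ (refl , _) | inj₁ refl = inj₂ refl
  ... | inj₂ (_ , refl) | inj₂ refl = inj₁ refl

  incidence-Joins : ∀ {e u w} → Joins G e u w → ∀ x → incidence e x ≡ δ u x xor δ w x
  incidence-Joins {e} j x with Joins⇒ends j
  ... | inj₁ (refl , refl) = refl
  ... | inj₂ (refl , refl) = xor-comm (δ (end₁ e) x) (δ (end₂ e) x)

  incidence⇒Touches : ∀ {e x} → incidence e x ≡ true → Touches e x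
  incidence⇒Touches {e} {x} h with end₁ e ≟ x | end₂ e ≟ x
  ... | yes p | _     = inj₁ p
  ... | no _  | yes q = inj₂ q
  incidence⇒Touches () | no _ | no _

  _++ᵂ_ : ∀ {S u v w} → Walk G S u v → Walk G S v w → Walk G S u w
  nil _        ++ᵂ Q = Q
  cons e s j P ++ᵂ Q = cons e s j (P ++ᵂ Q)

  walkEdges-++ᵂ : ∀ {S u v w} (P : Walk G S u v) (Q : Walk G S v w) →
                  walkEdges (P ++ᵂ Q) ≡ walkEdges P ++ walkEdges Q
  walkEdges-++ᵂ (nil _)        Q = refl
  walkEdges-++ᵂ (cons e s j P) Q = cong (e ∷_) (walkEdges-++ᵂ P Q)

  reverseᵂ : ∀ {S u v} → Walk G S u v → Walk G S v u
  reverseᵂ (nil v)        = nil v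
  reverseᵂ (cons e s j P) = reverseᵂ P ++ᵂ cons e s (Joins-sym j) (nil _)

  weaken : ∀ {S S′ u v} → S ⊆ S′ → Walk G S u v → Walk G S′ u v
  weaken S⊆S′ (nil v)        = nil v
  weaken S⊆S′ (cons e s j P) = cons e (S⊆S′ s) j (weaken S⊆S′ P)

  walkEdges-weaken : ∀ {S S′ u v} (S⊆S′ : S ⊆ S′) (P : Walk G S u v) →
                     walkEdges (weaken S⊆S′ P) ≡ walkEdges P
  walkEdges-weaken S⊆S′ (nil v)        = refl
  walkEdges-weaken S⊆S′ (cons e s j P) = cong (e ∷_) (walkEdges-weaken S⊆S′ P)

  reroute : ∀ {S S′} → (∀ {f x y} → S f ≡ true → Joins G f x y → Walk G S′ x y) →
            ∀ {u v} → Walk G S u v → Walk G S′ u v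
  reroute detour (nil v)        = nil v
  reroute detour (cons e s j P) = detour s j ++ᵂ reroute detour P

  ∈-walkEdges : ∀ {S u v f} (P : Walk G S u v) → f ∈ walkEdges P → S f ≡ true
  ∈-walkEdges (cons e s j P) (here refl) = s
  ∈-walkEdges (cons e s j P) (there f∈P) = ∈-walkEdges P f∈P

  ⟦_⟧ : ∀ {S u v} → Walk G S u v → C₁ G
  ⟦ P ⟧ e = odd (occ e (walkEdges P))

  ⟦cons⟧ : ∀ {S u v w f s} (j : Joins G f u w) (P : Walk G S w v) e →
           ⟦ cons f s j P ⟧ e ≡ (δ f ⊕ ⟦ P ⟧) e
  ⟦cons⟧ {f = f} j P e = trans (odd-+ (if δ f e then 1 else 0) _) (cong (_xor ⟦ P ⟧ e) (odd-indicator (δ f e)))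

  ∂⟦⟧ : ∀ {S u v} (P : Walk G S u v) x → ∂ ⟦ P ⟧ x ≡ δ u x xor δ v x
  ∂⟦⟧ {u = u} (nil _) x = trans (∑-false {nE G} (λ _ → refl)) (sym (xor-same (δ u x)))
  ∂⟦⟧ {u = u} {v} (cons {v = w} f s j P) x = begin
    ∂ ⟦ cons f s j P ⟧ x                     ≡⟨ ∂-cong (⟦cons⟧ {s = s} j P) x ⟩
    ∂ (δ f ⊕ ⟦ P ⟧) x                        ≡⟨ ∂-⊕ (δ f) ⟦ P ⟧ x ⟩
    ∂ (δ f) x xor ∂ ⟦ P ⟧ x                  ≡⟨ cong₂ _xor_ (trans (∂-δ f x) (incidence-Joins j x)) (∂⟦⟧ P x) ⟩
    (δ u x xor δ w x) xor (δ w x xor δ v x)  ≡⟨ xor-cancel-middle (δ u x) (δ w x) (δ v x) ⟩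
    δ u x xor δ v x                          ∎
    where open ≡-Reasoning

  ⟦⟧-∈ : ∀ {S u v f} (P : Walk G S u v) → Unique (walkEdges P) → f ∈ walkEdges P → ⟦ P ⟧ f ≡ true
  ⟦⟧-∈ P unique f∈P = cong odd (occ-unique-∈ unique f∈P)

  ⟦⟧-∉ : ∀ {S u v f} (P : Walk G S u v) → f ∉ walkEdges P → ⟦ P ⟧ f ≡ false
  ⟦⟧-∉ P f∉P = cong odd (occ-∉ f∉P)

  ⟦⟧⇒∈ : ∀ {S u v f} (P : Walk G S u v) → ⟦ P ⟧ f ≡ true → f ∈ walkEdges P
  ⟦⟧⇒∈ {f = f} P odd-occ with f ∈? walkEdges P
  ... | yes f∈P = f∈P
  ... | no  f∉P = case trans (sym odd-occ) (⟦⟧-∉ P f∉P) of λ ()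

  -- Hierholzer's construction

  OnWalk : ∀ {S u v} → Walk G S u v → V → Set
  OnWalk {u = u} P x = x ≡ u ⊎ Any (λ g → Touches g x) (walkEdges P)

  record SaturatedTrail (S : EdgeSet G) (u v : V) : Set where
    field
      walk      : Walk G S u v
      unique    : Unique (walkEdges walk)
      saturated : ∀ {f x} → S f ≡ true → OnWalk walk x → Touches f x → f ∈ walkEdges walk

  onWalk-propagates : ∀ {S u v a b} (T : SaturatedTrail S u v) → Walk G S a b →
                      OnWalk (SaturatedTrail.walk T) a → OnWalk (SaturatedTrail.walk T) b
  onWalk-propagates T (nil _)         on-a = on-a
  onWalk-propagates T (cons f Sf j P) on-a =
    onWalk-propagates T P (inj₂ (Any.map (λ { refl → Joins⇒Touches (Joins-sym j) }) f∈T))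
    where
    f∈T : f ∈ walkEdges (SaturatedTrail.walk T)
    f∈T = SaturatedTrail.saturated T Sf on-a (Joins⇒Touches j)

  emptyTrail : ∀ {S u} → (∀ {f} → S f ≡ true → ¬ Touches f u) → SaturatedTrail S u u
  emptyTrail {u = u} isolated = record
    { walk      = nil u
    ; unique    = []
    ; saturated = λ { Sf (inj₁ refl) t → ⊥-elim (isolated Sf t) ; _ (inj₂ ()) _ }
    }

  isolated⇒≡ : ∀ {S u v} → (∀ {f} → S f ≡ true → ¬ Touches f u) →
               (∀ x → ∂ S x ≡ δ u x xor δ v x) → u ≡ v
  isolated⇒≡ {S} {u} {v} isolated ∂S = sym (δ⇒≡ (trans (sym (not-involutive (δ v u))) (cong not ∂Su)))
    where
    no-term : ∀ f → S f ∧ incidence f u ≡ false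
    no-term f with S f in Sf
    ... | false = refl
    ... | true  = ¬-not (isolated Sf ∘ incidence⇒Touches)

    ∂Su : not (δ v u) ≡ false
    ∂Su = trans (sym (cong (_xor δ v u) (δ-refl u))) (trans (sym (∂S u)) (∑-false no-term))

  ⊕δ-⊆ : ∀ {S : EdgeSet G} {e} → S e ≡ true → (S ⊕ δ e) ⊆ S
  ⊕δ-⊆ {S} {e} Se {f} S′f with e ≟ f
  ... | yes refl = Se
  ... | no _     = trans (sym (xor-identityʳ (S f))) S′f

  ⊕δ-self : ∀ {S : EdgeSet G} {e} → S e ≡ true → (S ⊕ δ e) e ≡ false
  ⊕δ-self {e = e} Se = cong₂ _xor_ Se (δ-refl e)

  ⊕δ-other : ∀ {S : EdgeSet G} {e f} → f ≢ e → (S ⊕ δ e) f ≡ S f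
  ⊕δ-other {S} {e} {f} f≢e = trans (cong (S f xor_) (dec-false (e ≟ f) (f≢e ∘ sym))) (xor-identityʳ (S f))

  -- Having left u along e and found W from w to v in S ∖ e, the edges R of S ∖ e unused by W
  -- have boundary u + u, so a saturated trail C from u to u in R can be put in front: C, e, W.
  module Splice {S e u w v} (Se : S e ≡ true) (j : Joins G e u w)
                (W : SaturatedTrail (S ⊕ δ e) w v) where

    open SaturatedTrail W renaming (walk to W′; unique to W′-unique; saturated to W′-saturated)

    S′ R : EdgeSet G
    S′ = S ⊕ δ e
    R  = S′ ⊕ ⟦ W′ ⟧

    R⊆S′ : R ⊆ S′
    R⊆S′ {f} Rf with f ∈? walkEdges W′
    ... | yes f∈W′ = ∈-walkEdges W′ f∈W′
    ... | no  f∉W′ = trans (sym (xor-identityʳ (S′ f))) (trans (cong (S′ f xor_) (sym (⟦⟧-∉ W′ f∉W′))) Rf)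

    R-∉ : ∀ {f} → R f ≡ true → f ∉ walkEdges W′
    R-∉ Rf f∈W′ = case trans (sym Rf) (cong₂ _xor_ (∈-walkEdges W′ f∈W′) (⟦⟧-∈ W′ W′-unique f∈W′)) of λ ()

    R-intro : ∀ {f} → S′ f ≡ true → f ∉ walkEdges W′ → R f ≡ true
    R-intro {f} S′f f∉W′ = trans (cong (S′ f xor_) (⟦⟧-∉ W′ f∉W′)) (trans (xor-identityʳ (S′ f)) S′f)

    R-≢e : ∀ {f} → R f ≡ true → f ≢ e
    R-≢e Rf refl = case trans (sym (R⊆S′ Rf)) (⊕δ-self {S} Se) of λ ()

    splice : SaturatedTrail R u u → SaturatedTrail S u v
    splice C = record { walk = walk ; unique = unique ; saturated = saturated }
      where
      open SaturatedTrail C renaming (walk to C′; unique to C′-unique; saturated to C′-saturated)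

      R⊆S : R ⊆ S
      R⊆S = ⊕δ-⊆ {S} Se ∘ R⊆S′

      walk : Walk G S u v
      walk = weaken R⊆S C′ ++ᵂ cons e Se j (weaken (⊕δ-⊆ {S} Se) W′)

      edges : walkEdges walk ≡ walkEdges C′ ++ e ∷ walkEdges W′
      edges = trans (walkEdges-++ᵂ (weaken R⊆S C′) (cons e Se j (weaken (⊕δ-⊆ {S} Se) W′)))
                    (cong₂ (λ xs ys → xs ++ e ∷ ys) (walkEdges-weaken R⊆S C′) (walkEdges-weaken (⊕δ-⊆ {S} Se) W′))

      unique : Unique (walkEdges walk)
      unique = subst Unique (sym edges) (++⁺ C′-unique (e∉W′ ∷ W′-unique) disjoint)
        where
        e∉W′ : All (e ≢_) (walkEdges W′)
        e∉W′ = All.tabulate λ { f∈W′ refl → case trans (sym (∈-walkEdges W′ f∈W′)) (⊕δ-self {S} Se) of λ () }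

        disjoint : Disjoint (walkEdges C′) (e ∷ walkEdges W′)
        disjoint (f∈C , here f≡e)   = R-≢e (∈-walkEdges C′ f∈C) f≡e
        disjoint (f∈C , there f∈W′) = R-∉ (∈-walkEdges C′ f∈C) f∈W′

      saturated : ∀ {f x} → S f ≡ true → OnWalk walk x → Touches f x → f ∈ walkEdges walk
      saturated {f} {x} Sf on t with f ∈? walkEdges W′ | f ≟ e
      ... | yes f∈W′ | _        = subst (f ∈_) (sym edges) (∈-++⁺ʳ _ (there f∈W′))
      ... | no _     | yes refl = subst (f ∈_) (sym edges) (∈-++⁺ʳ _ (here refl))
      ... | no f∉W′  | no f≢e   =
        subst (f ∈_) (sym edges) (on-C-or-W′ (subst (λ es → x ≡ u ⊎ Any (λ g → Touches g x) es) edges on))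
        where
        S′f : S′ f ≡ true
        S′f = trans (⊕δ-other {S} f≢e) Sf

        on-C : OnWalk C′ x → f ∈ walkEdges C′ ++ e ∷ walkEdges W′
        on-C on-C′ = ∈-++⁺ˡ (C′-saturated (R-intro S′f f∉W′) on-C′ t)

        off-W′ : ¬ OnWalk W′ x
        off-W′ on-W′ = f∉W′ (W′-saturated S′f on-W′ t)

        on-C-or-W′ : x ≡ u ⊎ Any (λ g → Touches g x) (walkEdges C′ ++ e ∷ walkEdges W′) →
                     f ∈ walkEdges C′ ++ e ∷ walkEdges W′
        on-C-or-W′ (inj₁ x≡u) = on-C (inj₁ x≡u)
        on-C-or-W′ (inj₂ touching) with Any-++⁻ (walkEdges C′) touching
        ... | inj₁ touches-C      = on-C (inj₂ touches-C)
        ... | inj₂ (here e~x)     = Sum.[ on-C ∘ inj₁ , ⊥-elim ∘ off-W′ ∘ inj₁ ] (Touches-Joins j e~x)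
        ... | inj₂ (there touches-W′) = ⊥-elim (off-W′ (inj₂ touches-W′))

  saturatedTrail : ∀ {S u v} → Acc _<_ (size S) → (∀ x → ∂ S x ≡ δ u x xor δ v x) → SaturatedTrail S u v
  saturatedTrail {S} {u} {v} (acc rec) ∂S with any? (λ f → (S f ≟ᵇ true) ×-dec touches? f u)
  ... | no none = subst (SaturatedTrail S u) (isolated⇒≡ isolated ∂S) (emptyTrail isolated)
    where
    isolated : ∀ {f} → S f ≡ true → ¬ Touches f u
    isolated Sf t = none (_ , Sf , t)
  ... | yes (e , Se , e~u) = Splice.splice {S} Se j W (saturatedTrail (rec R<S) ∂R)
    where
    open ≡-Reasoning

    w : V
    w = proj₁ (Touches⇒Joins e~u)

    j : Joins G e u w
    j = proj₂ (Touches⇒Joins e~u)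

    S′<S : size (S ⊕ δ e) < size S
    S′<S = size-strict {p = S ⊕ δ e} {S} (⊕δ-⊆ {S} Se) Se (⊕δ-self {S} Se)

    ∂S′ : ∀ x → ∂ (S ⊕ δ e) x ≡ δ w x xor δ v x
    ∂S′ x = begin
      ∂ (S ⊕ δ e) x                            ≡⟨ ∂-⊕ S (δ e) x ⟩
      ∂ S x xor ∂ (δ e) x                      ≡⟨ cong₂ _xor_ (∂S x) (trans (∂-δ e x) (incidence-Joins j x)) ⟩
      (δ u x xor δ v x) xor (δ u x xor δ w x)  ≡⟨ cong (_xor (δ u x xor δ w x)) (xor-comm (δ u x) (δ v x)) ⟩
      (δ v x xor δ u x) xor (δ u x xor δ w x)  ≡⟨ xor-cancel-middle (δ v x) (δ u x) (δ w x) ⟩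
      δ v x xor δ w x                          ≡⟨ xor-comm (δ v x) (δ w x) ⟩
      δ w x xor δ v x                          ∎

    W : SaturatedTrail (S ⊕ δ e) w v
    W = saturatedTrail (rec S′<S) ∂S′

    open Splice {S} Se j W using (R; R⊆S′)

    W′ : Walk G (S ⊕ δ e) w v
    W′ = SaturatedTrail.walk W

    R<S : size R < size S
    R<S = ≤-<-trans (size-mono {p = R} {S ⊕ δ e} R⊆S′) S′<S

    ∂R : ∀ x → ∂ R x ≡ δ u x xor δ u x
    ∂R x = begin
      ∂ R x                                    ≡⟨ ∂-⊕ (S ⊕ δ e) ⟦ W′ ⟧ x ⟩
      ∂ (S ⊕ δ e) x xor ∂ ⟦ W′ ⟧ x             ≡⟨ cong₂ _xor_ (∂S′ x) (∂⟦⟧ W′ x) ⟩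
      (δ w x xor δ v x) xor (δ w x xor δ v x)  ≡⟨ xor-same (δ w x xor δ v x) ⟩
      false                                    ≡⟨ xor-same (δ u x) ⟨
      δ u x xor δ u x                          ∎

  cycle⇒∂≡δ⊕δ : ∀ {z} u → IsCycle z → ∀ x → ∂ z x ≡ δ u x xor δ u x
  cycle⇒∂≡δ⊕δ u cycle x = trans (cycle x) (sym (xor-same (δ u x)))

  -- Euler circuits and bridges

  eulerian⇒cycle : Eulerian G → IsCycle (𝟙 G)
  eulerian⇒cycle (v , P , once) x =
    trans (∂-cong (λ e → cong odd (sym (once e))) x) (trans (∂⟦⟧ P x) (xor-same (δ v x)))

  cycle⇒eulerian : Connected G → IsCycle (𝟙 G) → Eulerian G
  cycle⇒eulerian (r , path) cycle = r , walk , once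
    where
    euler : SaturatedTrail (𝟙 G) r r
    euler = saturatedTrail (<-wellFounded _) (cycle⇒∂≡δ⊕δ r cycle)
    open SaturatedTrail euler

    once : ∀ e → occ e (walkEdges walk) ≡ 1
    once e = occ-unique-∈ unique (saturated refl (onWalk-propagates euler (path r (end₁ e)) (inj₁ refl)) (inj₁ refl))

  cycle⇒bridgeless : Connected G → IsCycle (𝟙 G) → Bridgeless G
  cycle⇒bridgeless (r , path) cycle e = r , λ a b → reroute detour (path a b)
    where
    ∂G∖e : ∀ x → ∂ (without G e) x ≡ δ (end₁ e) x xor δ (end₂ e) x
    ∂G∖e x = begin
      ∂ (without G e) x        ≡⟨ ∂-cong (λ f → cong not (δ-sym f e)) x ⟩
      ∂ (𝟙 G ⊕ δ e) x          ≡⟨ ∂-⊕ (𝟙 G) (δ e) x ⟩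
      ∂ (𝟙 G) x xor ∂ (δ e) x  ≡⟨ cong₂ _xor_ (cycle x) (∂-δ e x) ⟩
      incidence e x            ∎
      where open ≡-Reasoning

    bypass : Walk G (without G e) (end₁ e) (end₂ e)
    bypass = SaturatedTrail.walk (saturatedTrail (<-wellFounded _) ∂G∖e)

    detour : ∀ {f x y} → 𝟙 G f ≡ true → Joins G f x y → Walk G (without G e) x y
    detour {f} _ j with f ≟ e
    ... | no f≢e = cons f (cong not (dec-false (f ≟ e) f≢e)) j (nil _)
    ... | yes refl with Joins⇒ends j
    ...   | inj₁ (refl , refl) = bypass
    ...   | inj₂ (refl , refl) = reverseᵂ bypass

  -- Spanning trees

  CycleFree : EdgeSet G → Set
  CycleFree T = ∀ z → IsCycle z → z ⊆ T → ∀ e → z e ≡ false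

  cycleFree⇒acyclic : ∀ {T} → CycleFree T → Acyclic G T
  cycleFree⇒acyclic free v (nil _)          unique = refl
  cycleFree⇒acyclic free v P@(cons e _ _ _) unique =
    case trans (sym (⟦⟧-∈ P unique (here refl))) (free ⟦ P ⟧ closed (∈-walkEdges P ∘ ⟦⟧⇒∈ P) e) of λ ()
    where
    closed : IsCycle ⟦ P ⟧
    closed x = trans (∂⟦⟧ P x) (xor-same (δ v x))

  acyclic⇒cycleFree : ∀ {T} → Acyclic G T → CycleFree T
  acyclic⇒cycleFree {T} acyclic z cycle z⊆T e = ¬-not λ ze → case e∈[] ze of λ ()
    where
    e∈[] : z e ≡ true → e ∈ []
    e∈[] ze = subst (e ∈_) (trans (sym (walkEdges-weaken z⊆T walk)) (acyclic _ (weaken z⊆T walk) unique-in-T))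
                    (saturated ze (inj₁ refl) (inj₁ refl))
      where
      open SaturatedTrail (saturatedTrail {z} {end₁ e} {end₁ e} (<-wellFounded _) (cycle⇒∂≡δ⊕δ (end₁ e) cycle))
      unique-in-T : Unique (walkEdges (weaken z⊆T walk))
      unique-in-T = subst Unique (sym (walkEdges-weaken z⊆T walk)) unique

  -- At q the boundary of a cycle z sees only the coefficient of e, as no edge of T touches q.
  cycleFree-∪δ : ∀ {T e p q} → CycleFree T → (∀ {f} → T f ≡ true → ¬ Touches f q) →
                 Joins G e p q → p ≢ q → CycleFree (T ∪ δ e)
  cycleFree-∪δ {T} {e} {p} {q} free q-fresh j p≢q z cycle z⊆T∪e = free z cycle z⊆T
    where
    off-e : ∀ f → f ≢ e → z f ∧ incidence f q ≡ false
    off-e f f≢e with z f in zf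
    ... | false = refl
    ... | true with ∪-elim {p = T} {δ e} (z⊆T∪e zf)
    ...   | inj₁ Tf  = ¬-not (q-fresh Tf ∘ incidence⇒Touches)
    ...   | inj₂ δef = ⊥-elim (f≢e (sym (δ⇒≡ δef)))

    incidence-e : incidence e q ≡ true
    incidence-e = trans (incidence-Joins j q) (cong₂ _xor_ (dec-false (p ≟ q) p≢q) (δ-refl q))

    ze : z e ≡ false
    ze = begin
      z e                  ≡⟨ ∧-identityʳ (z e) ⟨
      z e ∧ true           ≡⟨ cong (z e ∧_) incidence-e ⟨
      z e ∧ incidence e q  ≡⟨ ∑-supported e off-e ⟨
      ∂ z q                ≡⟨ cycle q ⟩
      false                ∎
      where open ≡-Reasoning

    z⊆T : z ⊆ T
    z⊆T {f} zf with ∪-elim {p = T} {δ e} (z⊆T∪e zf)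
    ... | inj₁ Tf  = Tf
    ... | inj₂ δef = case trans (sym zf) (subst (λ g → z g ≡ false) (δ⇒≡ δef) ze) of λ ()

  SpanningSubtree : EdgeSet G → Set
  SpanningSubtree S = Σ (EdgeSet G) λ T → T ⊆ S × SpanningTree G T

  module Prim (S : EdgeSet G) (r : V) where

    record TreeOn (Rch : V → Bool) : Set where
      field
        tree        : EdgeSet G
        tree⊆S      : tree ⊆ S
        tree-inside : ∀ {e} → tree e ≡ true → Rch (end₁ e) ≡ true × Rch (end₂ e) ≡ true
        root        : Rch r ≡ true
        reach       : ∀ {x} → Rch x ≡ true → Walk G tree r x
        cycleFree   : CycleFree tree

    start : TreeOn (δ r)
    start = record
      { tree        = λ _ → false
      ; tree⊆S      = λ ()
      ; tree-inside = λ ()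
      ; root        = δ-refl r
      ; reach       = λ r≡x → subst (Walk G _ r) (δ⇒≡ r≡x) (nil r)
      ; cycleFree   = λ z _ z⊆∅ e → ¬-not (λ ze → case z⊆∅ ze of λ ())
      }

    extend : ∀ {Rch e p q} → TreeOn Rch → S e ≡ true → Joins G e p q → Rch p ≡ true → Rch q ≡ false →
             TreeOn (Rch ∪ δ q)
    extend {Rch} {e} {p} {q} t Se j Rp Rq = record
      { tree        = tree ∪ δ e
      ; tree⊆S      = tree′⊆S
      ; tree-inside = inside
      ; root        = Rch⊆ root
      ; reach       = reach′
      ; cycleFree   = cycleFree-∪δ cycleFree q-fresh j p≢q
      }
      where
      open TreeOn t

      Rch⊆ : Rch ⊆ (Rch ∪ δ q)
      Rch⊆ = ∪-introˡ {p = Rch} {δ q}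

      tree⊆ : tree ⊆ (tree ∪ δ e)
      tree⊆ = ∪-introˡ {p = tree} {δ e}

      tree′⊆S : (tree ∪ δ e) ⊆ S
      tree′⊆S {f} h = Sum.[ tree⊆S , (λ δef → subst (λ f → S f ≡ true) (δ⇒≡ {i = e} {f} δef) Se) ]
                            (∪-elim {p = tree} {δ e} h)

      p≢q : p ≢ q
      p≢q refl = case trans (sym Rp) Rq of λ ()

      q-fresh : ∀ {f} → tree f ≡ true → ¬ Touches f q
      q-fresh Tf (inj₁ refl) = case trans (sym (proj₁ (tree-inside Tf))) Rq of λ ()
      q-fresh Tf (inj₂ refl) = case trans (sym (proj₂ (tree-inside Tf))) Rq of λ ()

      new : ∀ {x} → x ≡ p ⊎ x ≡ q → (Rch ∪ δ q) x ≡ true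
      new (inj₁ refl) = Rch⊆ Rp
      new (inj₂ refl) = ∪-introʳ {p = Rch} {δ q} (δ-refl q)

      inside : ∀ {f} → (tree ∪ δ e) f ≡ true → (Rch ∪ δ q) (end₁ f) ≡ true × (Rch ∪ δ q) (end₂ f) ≡ true
      inside {f} h with ∪-elim {p = tree} {δ e} h
      ... | inj₁ Tf = Product.map Rch⊆ Rch⊆ (tree-inside Tf)
      ... | inj₂ δef with δ⇒≡ {i = e} {f} δef
      ...   | refl = new (Touches-Joins j (inj₁ refl)) , new (Touches-Joins j (inj₂ refl))

      reach′ : ∀ {x} → (Rch ∪ δ q) x ≡ true → Walk G (tree ∪ δ e) r x
      reach′ {x} h with ∪-elim {p = Rch} {δ q} h
      ... | inj₁ Rx = weaken tree⊆ (reach Rx)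
      ... | inj₂ δqx with δ⇒≡ {i = q} {x} δqx
      ...   | refl = weaken tree⊆ (reach Rp) ++ᵂ cons e (∪-introʳ {p = tree} {δ e} (δ-refl e)) j (nil q)

    orient : ∀ {Rch : V → Bool} {e} → Rch (end₁ e) ≢ Rch (end₂ e) →
             ∃ λ p → ∃ λ q → Joins G e p q × Rch p ≡ true × Rch q ≡ false
    orient {Rch} {e} crossing with Rch (end₁ e) in R₁ | Rch (end₂ e) in R₂
    ... | true  | false = end₁ e , end₂ e , inj₁ refl , R₁ , R₂
    ... | false | true  = end₂ e , end₁ e , inj₂ refl , R₂ , R₁
    ... | true  | true  = ⊥-elim (crossing refl)
    ... | false | false = ⊥-elim (crossing refl)

    grow : ∀ {Rch} → Acc _<_ (size (not ∘ Rch)) → TreeOn Rch → (∀ x → Walk G S r x) → SpanningSubtree S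
    grow {Rch} (acc rec) t path with any? (λ f → (S f ≟ᵇ true) ×-dec ¬? (Rch (end₁ f) ≟ᵇ Rch (end₂ f)))
    ... | yes (e , Se , crossing) with orient {Rch} crossing
    ...   | p , q , j , Rp , Rq = grow (rec fewer) (extend t Se j Rp Rq) path
      where
      shrink : (not ∘ (Rch ∪ δ q)) ⊆ (not ∘ Rch)
      shrink {x} h with Rch x
      ... | false = refl

      fewer : size (not ∘ (Rch ∪ δ q)) < size (not ∘ Rch)
      fewer = size-strict {p = not ∘ (Rch ∪ δ q)} {not ∘ Rch} shrink (cong not Rq)
                (trans (cong (λ b → not (Rch q ∨ b)) (δ-refl q)) (cong not (∨-zeroʳ (Rch q))))
    grow {Rch} (acc rec) t path | no none =
      tree , tree⊆S , (r , λ a b → reverseᵂ (reach (reached a)) ++ᵂ reach (reached b)) , cycleFree⇒acyclic cycleFree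
      where
      open TreeOn t

      balanced : ∀ {f} → S f ≡ true → Rch (end₁ f) ≡ Rch (end₂ f)
      balanced Sf = decidable-stable (_ ≟ᵇ _) (λ crossing → none (_ , Sf , crossing))

      spread : ∀ {a b} → Walk G S a b → Rch a ≡ true → Rch b ≡ true
      spread (nil _)         Ra = Ra
      spread (cons f Sf j P) Ra with Joins⇒ends j
      ... | inj₁ (refl , refl) = spread P (trans (sym (balanced Sf)) Ra)
      ... | inj₂ (refl , refl) = spread P (trans (balanced Sf) Ra)

      reached : ∀ x → Rch x ≡ true
      reached x = spread (path x) root

  spanningSubtree : ∀ {S} → ConnectedOn G S → SpanningSubtree S
  spanningSubtree {S} (r , path) = Prim.grow S r (<-wellFounded _) (Prim.start S r) (path r)

  ρ≈𝟙ᵀ⇔ : ∀ {T : EdgeSet G} {y : C₁ G} → _≈C_ {G} (ρ {G} T y) (𝟙ᵀ {G} T) ⇔ (∀ f → T f ≡ false → y f ≡ true)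
  ρ≈𝟙ᵀ⇔ {T} {y} = mk⇔ (λ ρy f Tf → subst (λ t → (if t then false else y f) ≡ not t) Tf (ρy f)) from
    where
    from : (∀ f → T f ≡ false → y f ≡ true) → _≈C_ {G} (ρ {G} T y) (𝟙ᵀ {G} T)
    from off f with T f in Tf
    ... | true  = refl
    ... | false = off f Tf

  -- y = 𝟙_T + Σ_{e ∉ T} ⟦P e⟧, where P e joins the ends of e inside T, so that each summand
  -- δ e + ⟦P e⟧ is a cycle.
  ρ⁻¹𝟙ᵀ : ∀ {T} → ConnectedOn G T → Σ (C₁ G) (IsRhoInvOneT G T)
  ρ⁻¹𝟙ᵀ {T} (_ , path) = y , Equivalence.from InH₁⇔IsCycle cycle , Equivalence.from ρ≈𝟙ᵀ⇔ off-T
    where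
    P : (e : E) → Walk G T (end₁ e) (end₂ e)
    P e = path (end₁ e) (end₂ e)

    c : C₁ G
    c = 𝟙ᵀ {G} T

    y : C₁ G
    y = c ⊕ (λ f → ∑[ e < nE G ] (c e ∧ ⟦ P e ⟧ f))

    cycle : IsCycle y
    cycle x = begin
      ∂ y x                                                     ≡⟨ ∂-⊕ c _ x ⟩
      ∂ c x xor ∂ (λ f → ∑[ e < nE G ] (c e ∧ ⟦ P e ⟧ f)) x     ≡⟨ cong (∂ c x xor_) (∂-∑ c (λ e → ⟦ P e ⟧) x) ⟩
      ∂ c x xor ∑[ e < nE G ] (c e ∧ ∂ ⟦ P e ⟧ x)               ≡⟨ cong (∂ c x xor_) (sum-cong-≗ (λ e → cong (c e ∧_) (∂⟦⟧ (P e) x))) ⟩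
      ∂ c x xor ∂ c x                                           ≡⟨ xor-same (∂ c x) ⟩
      false                                                     ∎
      where open ≡-Reasoning

    off-T : ∀ f → T f ≡ false → y f ≡ true
    off-T f Tf = cong₂ _xor_ (cong not Tf) (∑-false λ e → trans (cong (c e ∧_) (⟦⟧-∉ (P e) (f∉P e))) (∧-zeroʳ (c e)))
      where
      f∉P : ∀ e → f ∉ walkEdges (P e)
      f∉P e f∈P = case trans (sym Tf) (∈-walkEdges (P e) f∈P) of λ ()

  RhoInvOneIsOne : Set
  RhoInvOneIsOne = (T : EdgeSet G) → SpanningTree G T → (y : C₁ G) → IsRhoInvOneT G T y → _≈C_ {G} y (𝟙 G)

  RhoInvOneUnique : Set
  RhoInvOneUnique = (T T′ : EdgeSet G) → SpanningTree G T → SpanningTree G T′ →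
                    (y y′ : C₁ G) → IsRhoInvOneT G T y → IsRhoInvOneT G T′ y′ → _≈C_ {G} y y′

  cycle⇒ρ⁻¹𝟙ᵀ≈𝟙 : IsCycle (𝟙 G) → RhoInvOneIsOne
  cycle⇒ρ⁻¹𝟙ᵀ≈𝟙 cycle T (_ , acyclic) y (y∈H₁ , ρy) f =
    trans (sym (not-involutive (y f))) (cong not (acyclic⇒cycleFree acyclic (𝟙 G ⊕ y) z-cycle z⊆T f))
    where
    z-cycle : IsCycle (𝟙 G ⊕ y)
    z-cycle x = trans (∂-⊕ (𝟙 G) y x) (cong₂ _xor_ (cycle x) (Equivalence.to InH₁⇔IsCycle y∈H₁ x))

    z⊆T : (𝟙 G ⊕ y) ⊆ T
    z⊆T {f} zf with T f in Tf
    ... | true  = refl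
    ... | false = case trans (sym zf) (cong not (Equivalence.to ρ≈𝟙ᵀ⇔ ρy f Tf)) of λ ()

  ρ⁻¹𝟙ᵀ≈𝟙⇒cycle : Connected G → RhoInvOneIsOne → IsCycle (𝟙 G)
  ρ⁻¹𝟙ᵀ≈𝟙⇒cycle connected isOne x =
    let (T , _ , tree)   = spanningSubtree connected
        (y , y∈H₁ , ρy) = ρ⁻¹𝟙ᵀ (proj₁ tree)
    in trans (∂-cong (sym ∘ isOne T tree y (y∈H₁ , ρy)) x) (Equivalence.to InH₁⇔IsCycle y∈H₁ x)

  ρ⁻¹𝟙ᵀ≈𝟙⇒unique : RhoInvOneIsOne → RhoInvOneUnique
  ρ⁻¹𝟙ᵀ≈𝟙⇒unique isOne T T′ tree tree′ y y′ iy iy′ f = trans (isOne T tree y iy f) (sym (isOne T′ tree′ y′ iy′ f))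

  unique⇒ρ⁻¹𝟙ᵀ≈𝟙 : Bridgeless G → RhoInvOneUnique → RhoInvOneIsOne
  unique⇒ρ⁻¹𝟙ᵀ≈𝟙 bridgeless unique T tree y iy f =
    let (T′ , T′⊆G∖f , tree′) = spanningSubtree (bridgeless f)
        (y′ , iy′)           = ρ⁻¹𝟙ᵀ (proj₁ tree′)
        f∉T′                 = ¬-not (λ T′f → case trans (sym (T′⊆G∖f T′f)) (cong not (δ-refl f)) of λ ())
    in trans (unique T T′ tree tree′ y y′ iy iy′ f) (Equivalence.to ρ≈𝟙ᵀ⇔ (proj₂ iy′) f f∉T′)

proposition4p1 : (G : Graph) → Connected G →
    (Eulerian G ⇔ ((v : Fin (nV G)) → 2 ∣ degree G v))
    × (((v : Fin (nV G)) → 2 ∣ degree G v) ⇔ InH₁ G (𝟙 G))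
    × (InH₁ G (𝟙 G) ⇔
        ((T : EdgeSet G) → SpanningTree G T →
          (y : C₁ G) → IsRhoInvOneT G T y → _≈C_ {G} y (𝟙 G)))
    × (((T : EdgeSet G) → SpanningTree G T →
          (y : C₁ G) → IsRhoInvOneT G T y → _≈C_ {G} y (𝟙 G)) ⇔
       (Bridgeless G ×
        ((T T′ : EdgeSet G) → SpanningTree G T → SpanningTree G T′ →
          (y y′ : C₁ G) → IsRhoInvOneT G T y → IsRhoInvOneT G T′ y′ →
          _≈C_ {G} y y′)))
proposition4p1 G connected =
    mk⇔ (from ∘ eulerian⇒cycle G) (cycle⇒eulerian G connected ∘ to)
  , mk⇔ id id
  , mk⇔ (cycle⇒ρ⁻¹𝟙ᵀ≈𝟙 G ∘ to) (from ∘ ρ⁻¹𝟙ᵀ≈𝟙⇒cycle G connected)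
  , mk⇔ (λ isOne → cycle⇒bridgeless G connected (ρ⁻¹𝟙ᵀ≈𝟙⇒cycle G connected isOne) , ρ⁻¹𝟙ᵀ≈𝟙⇒unique G isOne)
        (λ (bridgeless , unique) → unique⇒ρ⁻¹𝟙ᵀ≈𝟙 G bridgeless unique)
  where open Equivalence (InH₁⇔IsCycle G {𝟙 G})
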